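{- For every $n\in\mathbb{N}$, any algorithm that decides whether a given oriented graphic matroid on the $n$ elements $\{1,\dots,n\}$ contains a directed circuit of even size, accessing the oriented matroid only via a circuit oracle, must use at least $2^{n-1}-1$ oracle calls on some instance.
   Context: An oriented matroid is given by a ground set and a family of signed circuits $(C^+,C^-)$; a signed circuit is directed if $C^+=\emptyset$ or $C^-=\emptyset$, and its support is then a directed circuit. For a digraph $D$, the oriented graphic matroid $M(D)$ on $E(D)$ has as signed circuits, for each cycle of $D$, the partition of its edges into forward and backward edges relative to a traversal (both directions); an oriented graphic matroid is one isomorphic to some $M(D)$. The circuit oracle, given a subset of the ground set together with a $\{+,-\}$-sign for each of its elements, answers whether this signed set is a signed circuit. -}

module Defs where

open import Data.Nat using (ℕ; zero; suc; _+_)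
open import Data.Nat.Divisibility using (_∣_)
open import Data.Fin using (Fin; zero; suc)
open import Data.List using (map; allFin)
open import Data.Nat.ListAction using (sum)
open import Data.Bool using (Bool; true; false)
open import Data.Unit using (⊤; tt)
open import Data.Sum using (_⊎_; inj₁; inj₂; [_,_]′)
open import Data.Product using (Σ; ∃; _×_)
open import Function using (const)
open import Function.Bundles using (_⇔_)
open import Function.Definitions using (Injective)
open import Relation.Binary.PropositionalEquality using (_≡_; _≢_)

-- A sign vector on ground set Fin n: zero = element not in the subset,
-- plus / minus = element in C⁺ / C⁻.
data Sign : Set where
  𝟎 ⊕ ⊖ : Sign

SignVec : ℕ → Set
SignVec n = Fin n → Sign

-- A (multi)digraph with edge set Fin n (loops and parallel edges allowed).
record Digraph (n : ℕ) : Set where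
  field
    V    : ℕ
    tail : Fin n → Fin V
    head : Fin n → Fin V
open Digraph public

lastOr : ∀ {m} → Fin (suc m) → Fin m ⊎ ⊤
lastOr {zero}  zero    = inj₂ tt
lastOr {suc m} zero    = inj₁ zero
lastOr {suc m} (suc i) = [ (λ j → inj₁ (suc j)) , inj₂ ]′ (lastOr i)

next : ∀ {m} → Fin (suc m) → Fin (suc m)
next i = [ suc , const zero ]′ (lastOr i)

Traverses : ∀ {n} (D : Digraph n) → Fin n → Fin (V D) → Fin (V D) → Sign → Set
Traverses D e u w s =
  (s ≡ ⊕ × tail D e ≡ u × head D e ≡ w) ⊎ (s ≡ ⊖ × tail D e ≡ w × head D e ≡ u)

-- X is a signed circuit of M(D): there is a cycle v₀ e₀ v₁ e₁ … v_m e_m v₀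
-- (k = m+1 ≥ 1 distinct vertices, distinct edges) and X records the edges of the
-- cycle with their forward/backward sign and is zero off the cycle.
SignedCycle : ∀ {n} → Digraph n → SignVec n → Set
SignedCycle {n} D X =
  Σ ℕ λ m →
  Σ (Fin (suc m) → Fin (V D)) λ vs →
  Σ (Fin (suc m) → Fin n) λ es →
    Injective _≡_ _≡_ vs × Injective _≡_ _≡_ es
    × (∀ i → Traverses D (es i) (vs i) (vs (next i)) (X (es i)))
    × (∀ e → (∀ i → es i ≢ e) → X e ≡ 𝟎)

Oracle : ℕ → Set
Oracle n = SignVec n → Bool

OrientedGraphic : ∀ n → Oracle n → Set
OrientedGraphic n C = Σ (Digraph n) λ D → ∀ X → (C X ≡ true) ⇔ SignedCycle D X

nz : Sign → ℕ
nz 𝟎 = 0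
nz ⊕ = 1
nz ⊖ = 1

supportSize : ∀ {n} → SignVec n → ℕ
supportSize {n} X = sum (map (λ e → nz (X e)) (allFin n))

Directed : ∀ {n} → SignVec n → Set
Directed X = (∀ e → X e ≢ ⊖) ⊎ (∀ e → X e ≢ ⊕)

HasEvenDirectedCircuit : ∀ {n} → Oracle n → Set
HasEvenDirectedCircuit {n} C =
  ∃ λ (X : SignVec n) → C X ≡ true × Directed X × (2 ∣ supportSize X)

-- Deterministic adaptive algorithms accessing the input only via the oracle
-- = decision trees whose internal nodes are oracle queries.
data DTree (n : ℕ) : Set where
  leaf  : Bool → DTree n
  query : SignVec n → (ifTrue ifFalse : DTree n) → DTree n

run : ∀ {n} → DTree n → Oracle n → Bool
run (leaf b) C = b
run (query X t f) C with C X
... | true  = run t C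
... | false = run f C

calls : ∀ {n} → DTree n → Oracle n → ℕ
calls (leaf b) C = 0
calls (query X t f) C with C X
... | true  = suc (calls t C)
... | false = suc (calls f C)

DecidesEvenDirectedCircuit : ∀ {n} → DTree n → Set
DecidesEvenDirectedCircuit {n} T =
  ∀ C → OrientedGraphic n C → (run T C ≡ true) ⇔ HasEvenDirectedCircuit C

-- For a nonempty S ⊆ {1,…,n} let D_S be the digraph whose edges in S form one directed
-- cycle, every other edge being isolated. The signed circuits of M(D_S) are exactly ±S, so
-- its circuit oracle says yes only on ±S; for S = ∅ it never says yes, and there is no
-- circuit at all. A correct algorithm must answer yes on D_S for every nonempty even S,
-- but no on D_∅. On the oracle of D_∅ a query can tell it apart from the oracle of D_S only
-- if its support is S, so the run on D_∅ must query the support of each of the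
-- 2^(n-1) - 1 nonempty even subsets separately.
module Submission where

open import Defs
open import Data.Bool using (Bool; true; false)
open import Data.Bool.Properties using (T-≡; T-not-≡)
open import Data.Fin using (Fin; zero; suc; fromℕ; inject₁; opposite; join; splitAt)
open import Data.Fin.Induction using (<-weakInduction; >-weakInduction)
open import Data.Fin.Properties using (opposite-involutive; splitAt-join; toℕ<n; any?; all?)
  renaming (_≟_ to _≟ᶠ_)
open import Data.Fin.Subset using (Subset; inside; outside; ∣_∣; ⊥)
open import Data.Fin.Subset.Properties using (∣⊥∣≡0)
open import Data.List using (List; []; _∷_; [_]; _++_; map; length)
import Data.List as List
open import Data.List.Membership.Propositional using (_∈_)
open import Data.List.Membership.Propositional.Properties
  using (∈-∃++; ∈-++⁻; ∈-++⁺ˡ; ∈-++⁺ʳ; ∈-map⁺; ∈-map⁻)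
open import Data.List.Properties using (length-map; length-++; length-++-sucʳ; map-tabulate)
open import Data.List.Relation.Binary.Subset.Propositional using (_⊆_)
open import Data.List.Relation.Unary.All as All using (All; []; _∷_)
import Data.List.Relation.Unary.All.Properties as All
open import Data.List.Relation.Unary.AllPairs using ([]; _∷_)
open import Data.List.Relation.Unary.Any using (here; there)
open import Data.List.Relation.Unary.Unique.Propositional using (Unique)
import Data.List.Relation.Unary.Unique.Propositional.Properties as Unique
open import Data.Nat using (ℕ; zero; suc; _+_; _^_; _∸_; _≤_; _<_; _<?_; z≤n; s≤s)
open import Data.Nat.Divisibility using (_∣_; _∣0; ∣-refl; ∣m∣n⇒∣m+n)
open import Data.Nat.ListAction using (sum)
open import Data.Nat.Properties using (≤-<-trans; +-identityʳ; n≢0⇒n>0; module ≤-Reasoning)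
open import Data.Product as Product using (∃; _×_; _,_; proj₁; proj₂)
open import Data.Sum as Sum using (_⊎_; inj₁; inj₂; [_,_]′)
open import Data.Sum.Properties using (inj₁-injective)
open import Data.Unit using (tt)
open import Data.Vec using ([]; _∷_; lookup; tabulate)
open import Data.Vec.Properties using (∷-injectiveʳ; tabulate-cong; tabulate∘lookup)
open import Function using (_∘_; id; const)
open import Function.Bundles using (_⇔_; mk⇔; Equivalence)
open import Function.Definitions using (Injective)
import Function.Properties.Equivalence as ⇔
open import Level using (Level)
open import Relation.Binary.Definitions using (DecidableEquality)
open import Relation.Binary.PropositionalEquality hiding ([_])
open import Relation.Nullary using (¬_; Dec; yes; no; contradiction)
open import Relation.Nullary.Decidable
  using (⌊_⌋; _×-dec_; _⊎-dec_; toWitness; fromWitness; fromWitnessFalse)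
open import Relation.Unary using (Pred)

private
  variable
    a : Level
    m n k : ℕ
    D : Digraph n
    X Y : SignVec n

-- The cyclic successor on Fin

lastOr-inject₁ : (j : Fin m) → lastOr (inject₁ j) ≡ inj₁ j
lastOr-inject₁ {suc m} zero    = refl
lastOr-inject₁ {suc m} (suc j) rewrite lastOr-inject₁ j = refl

lastOr-fromℕ : ∀ m → lastOr (fromℕ m) ≡ inj₂ tt
lastOr-fromℕ zero    = refl
lastOr-fromℕ (suc m) rewrite lastOr-fromℕ m = refl

next-inject₁ : (j : Fin m) → next (inject₁ j) ≡ suc j
next-inject₁ j rewrite lastOr-inject₁ j = refl

next-fromℕ : ∀ m → next (fromℕ m) ≡ zero
next-fromℕ m rewrite lastOr-fromℕ m = refl

fromℕ-or-inject₁ : (P : Pred (Fin (suc m)) a) →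
                   P (fromℕ m) → (∀ j → P (inject₁ j)) → ∀ i → P i
fromℕ-or-inject₁ P P-fromℕ P-inject₁ = >-weakInduction P P-fromℕ (λ j _ → P-inject₁ j)

-- From j walk up to the last index, wrap around to zero, and sweep up again.
next-induction : (P : Pred (Fin (suc m)) a) {j : Fin (suc m)} →
                 P j → (∀ i → P i → P (next i)) → ∀ i → P i
next-induction {m = m} P {j} Pj step = <-weakInduction P P-zero step-inject₁
  where
  step-inject₁ : ∀ i → P (inject₁ i) → P (suc i)
  step-inject₁ i = subst P (next-inject₁ i) ∘ step (inject₁ i)

  reaches-fromℕ : ∀ i → P i → P (fromℕ m)
  reaches-fromℕ = >-weakInduction (λ i → P i → P (fromℕ m)) id
                    (λ i reach → reach ∘ step-inject₁ i)

  P-zero : P zero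
  P-zero = subst P (next-fromℕ m) (step _ (reaches-fromℕ j Pj))

opposite-fromℕ : ∀ m → opposite (fromℕ m) ≡ zero
opposite-fromℕ zero    = refl
opposite-fromℕ (suc m) = cong inject₁ (opposite-fromℕ m)

opposite-inject₁ : (j : Fin m) → opposite (inject₁ j) ≡ suc (opposite j)
opposite-inject₁ zero    = refl
opposite-inject₁ (suc j) = cong inject₁ (opposite-inject₁ j)

opposite-injective : Injective _≡_ _≡_ (opposite {m})
opposite-injective {x = x} {y} eq =
  trans (sym (opposite-involutive x)) (trans (cong opposite eq) (opposite-involutive y))

next-opposite-next : (i : Fin (suc m)) → next (opposite (next i)) ≡ opposite i
next-opposite-next {m} = fromℕ-or-inject₁ _ at-fromℕ at-inject₁
  where
  at-fromℕ : next (opposite (next (fromℕ m))) ≡ opposite (fromℕ m)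
  at-fromℕ rewrite next-fromℕ m | next-fromℕ m = sym (opposite-fromℕ m)

  at-inject₁ : ∀ j → next (opposite (next (inject₁ j))) ≡ opposite (inject₁ j)
  at-inject₁ j rewrite next-inject₁ j | next-inject₁ (opposite j) = sym (opposite-inject₁ j)

next-injective : Injective _≡_ _≡_ (next {m})
next-injective {x = x} {y} eq = begin
  x                                   ≡⟨ opposite-involutive x ⟨
  opposite (opposite x)               ≡⟨ cong opposite (next-opposite-next x) ⟨
  opposite (next (opposite (next x))) ≡⟨ cong (opposite ∘ next ∘ opposite) eq ⟩
  opposite (next (opposite (next y))) ≡⟨ cong opposite (next-opposite-next y) ⟩
  opposite (opposite y)               ≡⟨ opposite-involutive y ⟩
  y                                   ∎
  where open ≡-Reasoning

rotate : Fin k → Fin k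
rotate {suc k} = next

rotate-injective : Injective _≡_ _≡_ (rotate {k})
rotate-injective {suc k} = next-injective

rotate-induction : (P : Pred (Fin k) a) {j : Fin k} →
                   P j → (∀ i → P i → P (rotate i)) → ∀ i → P i
rotate-induction {suc k} P = next-induction P

-- Signed cycles

negate : Sign → Sign
negate 𝟎 = 𝟎
negate ⊕ = ⊖
negate ⊖ = ⊕

negate-involutive : ∀ s → negate (negate s) ≡ s
negate-involutive 𝟎 = refl
negate-involutive ⊕ = refl
negate-involutive ⊖ = refl

Traverses-reverse : ∀ (D : Digraph n) {e u w s} →
                    Traverses D e u w s → Traverses D e w u (negate s)
Traverses-reverse D (inj₁ (refl , t , h)) = inj₂ (refl , t , h)
Traverses-reverse D (inj₂ (refl , t , h)) = inj₁ (refl , t , h)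

Traverses-forward : ∀ (D : Digraph n) {e u w s} →
                    s ≡ ⊕ → Traverses D e u w s → tail D e ≡ u × head D e ≡ w
Traverses-forward D _   (inj₁ (_ , t , h)) = t , h
Traverses-forward D s≡⊕ (inj₂ (s≡⊖ , _))  = contradiction (trans (sym s≡⊕) s≡⊖) λ ()

SignedCycle-resp : X ≗ Y → SignedCycle D X → SignedCycle D Y
SignedCycle-resp {D = D} X≗Y (m , vs , es , vs-inj , es-inj , trav , off) =
  m , vs , es , vs-inj , es-inj ,
  (λ i → subst (Traverses D (es i) (vs i) (vs (next i))) (X≗Y (es i)) (trav i)) ,
  (λ e e∉ → trans (sym (X≗Y e)) (off e e∉))

SignedCycle-reverse : SignedCycle D X → SignedCycle D (negate ∘ X)
SignedCycle-reverse {D = D} {X = X} (m , vs , es , vs-inj , es-inj , trav , off) =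
  m , vs ∘ next ∘ opposite , es ∘ opposite ,
  (λ eq → opposite-injective (next-injective (vs-inj eq))) ,
  (λ eq → opposite-injective (es-inj eq)) ,
  traverses ,
  (λ e e∉ → cong negate (off e λ i → e∉ (opposite i) ∘ trans (cong es (opposite-involutive i))))
  where
  traverses : ∀ i → Traverses D (es (opposite i)) (vs (next (opposite i)))
                      (vs (next (opposite (next i)))) (negate (X (es (opposite i))))
  traverses i rewrite next-opposite-next i = Traverses-reverse D (trav (opposite i))

nonzero⇒onCycle : {es : Fin (suc m) → Fin n} → (∀ e → (∀ i → es i ≢ e) → X e ≡ 𝟎) →
                  ∀ {e} → X e ≢ 𝟎 → ∃ λ i → es i ≡ e
nonzero⇒onCycle {es = es} off {e} Xe≢𝟎 with any? (λ i → es i ≟ᶠ e)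
... | yes found = found
... | no  ∄i    = contradiction (off e λ i eq → ∄i (i , eq)) Xe≢𝟎

module _ {D : Digraph n} (head-injective : Injective _≡_ _≡_ (head D))
         {X : SignVec n} {vs : Fin (suc m) → Fin (V D)} {es : Fin (suc m) → Fin n}
         (traverses : ∀ i → Traverses D (es i) (vs i) (vs (next i)) (X (es i))) where

  -- A backward edge after a forward one would share its head with it.
  forward-next : ∀ i → X (es i) ≡ ⊕ → X (es (next i)) ≡ ⊕
  forward-next i fwd with traverses (next i)
  ... | inj₁ (fwd′ , _)    = fwd′
  ... | inj₂ (_ , _ , hd′) = trans (cong X (head-injective (trans hd′ (sym hd)))) fwd
    where hd = proj₂ (Traverses-forward D fwd (traverses i))

  all-forward : ∀ {j} → X (es j) ≡ ⊕ → ∀ i → X (es i) ≡ ⊕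
  all-forward fwd = next-induction (λ i → X (es i) ≡ ⊕) fwd forward-next

  forward-link : ∀ {j} → X (es j) ≡ ⊕ → ∀ i → head D (es i) ≡ tail D (es (next i))
  forward-link fwd i = trans (proj₂ (ends i)) (sym (proj₁ (ends (next i))))
    where ends = λ i → Traverses-forward D (all-forward fwd i) (traverses i)

-- One directed cycle and isolated edges

encode : Fin k ⊎ (Fin n ⊎ Fin n) → Fin (k + (n + n))
encode {k} {n} = join k (n + n) ∘ Sum.map₂ (join n n)

encode-injective : Injective _≡_ _≡_ (encode {k} {n})
encode-injective {k} {n} {x} {y} eq =
  trans (sym (decode-encode x)) (trans (cong decode eq) (decode-encode y))
  where
  decode : Fin (k + (n + n)) → Fin k ⊎ (Fin n ⊎ Fin n)
  decode = Sum.map₂ (splitAt n) ∘ splitAt k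

  decode-encode : ∀ x → decode (encode x) ≡ x
  decode-encode (inj₁ q) rewrite splitAt-join k (n + n) (inj₁ q) = refl
  decode-encode (inj₂ v) rewrite splitAt-join k (n + n) (inj₂ (join n n v)) =
    cong inj₂ (splitAt-join n n v)

-- An edge e with ℓ e = inj₁ q runs from cycle vertex q to cycle vertex q + 1 (mod k);
-- an edge with ℓ e = inj₂ e′ runs between two private vertices inj₂ (inj₁ e′), inj₂ (inj₂ e′).
cycleDigraph : (Fin n → Fin k ⊎ Fin n) → Digraph n
cycleDigraph {n} {k} ℓ = record
  { V    = k + (n + n)
  ; tail = encode ∘ Sum.map₂ inj₁ ∘ ℓ
  ; head = encode ∘ Sum.map rotate inj₂ ∘ ℓ
  }

cycleVector : (Fin n → Fin k ⊎ Fin n) → Sign → SignVec n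
cycleVector ℓ s = [ const s , const 𝟎 ]′ ∘ ℓ

negate-cycleVector : (ℓ : Fin n → Fin k ⊎ Fin n) → ∀ s e →
                     negate (cycleVector ℓ s e) ≡ cycleVector ℓ (negate s) e
negate-cycleVector ℓ s e with ℓ e
... | inj₁ _ = refl
... | inj₂ _ = refl

module _ (ℓ : Fin n → Fin k ⊎ Fin n) (ℓ-injective : Injective _≡_ _≡_ ℓ) where

  private
    G = cycleDigraph ℓ

  head-injective : Injective _≡_ _≡_ (head G)
  head-injective = ℓ-injective ∘ map-injective ∘ encode-injective
    where
    map-injective : ∀ {x y} → Sum.map rotate (inj₂ {A = Fin n}) x ≡ Sum.map rotate inj₂ y → x ≡ y
    map-injective {inj₁ _} {inj₁ _} eq   = cong inj₁ (rotate-injective (inj₁-injective eq))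
    map-injective {inj₂ _} {inj₂ _} refl = refl

  head≡tail : ∀ {e e′} → head G e ≡ tail G e′ → ∃ λ q → ℓ e ≡ inj₁ q × ℓ e′ ≡ inj₁ (rotate q)
  head≡tail eq = meet (encode-injective eq)
    where
    meet : ∀ {x y} → Sum.map rotate (inj₂ {A = Fin n}) x ≡ Sum.map₂ inj₁ y →
           ∃ λ q → x ≡ inj₁ q × y ≡ inj₁ (rotate q)
    meet {inj₁ q} {inj₁ _} refl = q , refl , refl
    meet {inj₂ _} {inj₁ _} ()
    meet {inj₂ _} {inj₂ _} ()

  SignedCycle-⊕⇒cycleVector : SignedCycle G X → ∀ {e} → X e ≡ ⊕ → 0 < k × X ≗ cycleVector ℓ ⊕
  SignedCycle-⊕⇒cycleVector {X = X} (_ , _ , es , _ , _ , trav , off) {e} Xe≡⊕ =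
    ≤-<-trans z≤n (toℕ<n (proj₁ (link i₀))) , agrees
    where
    start : ∃ λ i → es i ≡ e
    start = nonzero⇒onCycle off λ Xe≡𝟎 → contradiction (trans (sym Xe≡⊕) Xe≡𝟎) λ ()

    i₀ : Fin _
    i₀ = proj₁ start

    fwd₀ : X (es i₀) ≡ ⊕
    fwd₀ = trans (cong X (proj₂ start)) Xe≡⊕

    link : ∀ i → ∃ λ q → ℓ (es i) ≡ inj₁ q × ℓ (es (next i)) ≡ inj₁ (rotate q)
    link i = head≡tail (forward-link {D = G} head-injective {X = X} trav fwd₀ i)

    Hit : Fin k → Set
    Hit q = ∃ λ i → ℓ (es i) ≡ inj₁ q

    hit-rotate : ∀ q → Hit q → Hit (rotate q)
    hit-rotate q (i , hit) with link i
    ... | _ , at-i , at-next =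
      next i , trans at-next (cong (inj₁ ∘ rotate) (inj₁-injective (trans (sym at-i) hit)))

    all-hit : ∀ q → Hit q
    all-hit = rotate-induction Hit (i₀ , proj₁ (proj₂ (link i₀))) hit-rotate

    agrees : ∀ f → X f ≡ cycleVector ℓ ⊕ f
    agrees f with ℓ f in ℓf
    ... | inj₁ q with i , hit ← all-hit q =
      trans (cong X (ℓ-injective (trans ℓf (sym hit))))
            (all-forward {D = G} head-injective {X = X} trav fwd₀ i)
    ... | inj₂ _ = off f λ i es≡f →
      contradiction (trans (sym (proj₁ (proj₂ (link i)))) (trans (cong ℓ es≡f) ℓf)) λ ()

SignedCycle-cycleVector : (ℓ : Fin n → Fin k ⊎ Fin n) → Injective _≡_ _≡_ ℓ →
                    (σ : Fin k → Fin n) → (∀ q → ℓ (σ q) ≡ inj₁ q) →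
                    0 < k → SignedCycle (cycleDigraph ℓ) (cycleVector ℓ ⊕)
SignedCycle-cycleVector {n} {k = suc m} ℓ ℓ-injective σ ℓ∘σ _ =
  m , encode {n = n} ∘ inj₁ , σ ,
  (λ eq → inj₁-injective (encode-injective {n = n} eq)) ,
  (λ eq → inj₁-injective (trans (sym (ℓ∘σ _)) (trans (cong ℓ eq) (ℓ∘σ _)))) ,
  traverses , off
  where
  traverses : ∀ q → Traverses (cycleDigraph ℓ) (σ q) (encode {n = n} (inj₁ q))
                      (encode {n = n} (inj₁ (next q))) (cycleVector ℓ ⊕ (σ q))
  traverses q rewrite ℓ∘σ q = inj₁ (refl , refl , refl)

  off : ∀ e → (∀ q → σ q ≢ e) → cycleVector ℓ ⊕ e ≡ 𝟎
  off e e∉ with ℓ e in ℓe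
  ... | inj₁ q = contradiction (ℓ-injective (trans (ℓ∘σ q) (sym ℓe))) (e∉ q)
  ... | inj₂ _ = refl

SignedCycle-cycleDigraph : (ℓ : Fin n → Fin k ⊎ Fin n) → Injective _≡_ _≡_ ℓ →
                           (σ : Fin k → Fin n) → (∀ q → ℓ (σ q) ≡ inj₁ q) → ∀ X →
                           SignedCycle (cycleDigraph ℓ) X ⇔
                           (0 < k × (X ≗ cycleVector ℓ ⊕ ⊎ X ≗ cycleVector ℓ ⊖))
SignedCycle-cycleDigraph {k = k} ℓ ℓ-injective σ ℓ∘σ X = mk⇔ classify build
  where
  G = cycleDigraph ℓ

  classify : SignedCycle G X → 0 < k × (X ≗ cycleVector ℓ ⊕ ⊎ X ≗ cycleVector ℓ ⊖)
  classify c@(_ , _ , _ , _ , _ , trav , _) with trav zero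
  ... | inj₁ (fwd , _) = Product.map₂ inj₁ (SignedCycle-⊕⇒cycleVector ℓ ℓ-injective c fwd)
  ... | inj₂ (bwd , _) = Product.map₂ (inj₂ ∘ backward)
      (SignedCycle-⊕⇒cycleVector ℓ ℓ-injective (SignedCycle-reverse {D = G} c) (cong negate bwd))
    where
    backward : negate ∘ X ≗ cycleVector ℓ ⊕ → X ≗ cycleVector ℓ ⊖
    backward −X≗ e = trans (sym (negate-involutive (X e)))
                       (trans (cong negate (−X≗ e)) (negate-cycleVector ℓ ⊕ e))

  positive : 0 < k → SignedCycle G (cycleVector ℓ ⊕)
  positive = SignedCycle-cycleVector ℓ ℓ-injective σ ℓ∘σ

  build : 0 < k × (X ≗ cycleVector ℓ ⊕ ⊎ X ≗ cycleVector ℓ ⊖) → SignedCycle G X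
  build (0<k , inj₁ X≗) = SignedCycle-resp {D = G} (sym ∘ X≗) (positive 0<k)
  build (0<k , inj₂ X≗) =
    SignedCycle-resp {D = G} (λ e → trans (negate-cycleVector ℓ ⊕ e) (sym (X≗ e)))
                     (SignedCycle-reverse {D = G} (positive 0<k))

-- Circuit oracles of subsets

-- Position of e among the elements of p when e ∈ p, and e itself otherwise.
locate : (p : Subset n) → Fin n → Fin ∣ p ∣ ⊎ Fin n
locate (inside  ∷ p) zero    = inj₁ zero
locate (outside ∷ p) zero    = inj₂ zero
locate (inside  ∷ p) (suc e) = Sum.map suc suc (locate p e)
locate (outside ∷ p) (suc e) = Sum.map₂ suc (locate p e)

select : (p : Subset n) → Fin ∣ p ∣ → Fin n
select (inside  ∷ p) zero    = zero
select (inside  ∷ p) (suc q) = suc (select p q)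
select (outside ∷ p) q       = suc (select p q)

locate-select : ∀ (p : Subset n) q → locate p (select p q) ≡ inj₁ q
locate-select (inside  ∷ p) zero    = refl
locate-select (inside  ∷ p) (suc q) rewrite locate-select p q = refl
locate-select (outside ∷ p) q       rewrite locate-select p q = refl

locate-retraction : ∀ (p : Subset n) e → [ select p , id ]′ (locate p e) ≡ e
locate-retraction (inside  ∷ p) zero = refl
locate-retraction (outside ∷ p) zero = refl
locate-retraction (inside  ∷ p) (suc e) with locate p e | locate-retraction p e
... | inj₁ _ | refl = refl
... | inj₂ _ | refl = refl
locate-retraction (outside ∷ p) (suc e) with locate p e | locate-retraction p e
... | inj₁ _ | refl = refl
... | inj₂ _ | refl = refl

locate-injective : (p : Subset n) → Injective _≡_ _≡_ (locate p)
locate-injective p {e} {e′} eq = begin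
  e                                 ≡⟨ locate-retraction p e ⟨
  [ select p , id ]′ (locate p e)  ≡⟨ cong [ select p , id ]′ eq ⟩
  [ select p , id ]′ (locate p e′) ≡⟨ locate-retraction p e′ ⟩
  e′                                ∎
  where open ≡-Reasoning

lookup-locate : ∀ (p : Subset n) e → lookup p e ≡ [ const inside , const outside ]′ (locate p e)
lookup-locate (inside  ∷ p) zero = refl
lookup-locate (outside ∷ p) zero = refl
lookup-locate (inside  ∷ p) (suc e) with locate p e | lookup-locate p e
... | inj₁ _ | eq = eq
... | inj₂ _ | eq = eq
lookup-locate (outside ∷ p) (suc e) with locate p e | lookup-locate p e
... | inj₁ _ | eq = eq
... | inj₂ _ | eq = eq

infix 25 _⟨_⟩
_⟨_⟩ : Subset n → Sign → SignVec n
p ⟨ s ⟩ = cycleVector (locate p) s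

⟨⊕⟩-directed : ∀ (p : Subset n) e → (p ⟨ ⊕ ⟩) e ≢ ⊖
⟨⊕⟩-directed p e with locate p e
... | inj₁ _ = λ ()
... | inj₂ _ = λ ()

isNonzero : Sign → Bool
isNonzero 𝟎 = false
isNonzero ⊕ = true
isNonzero ⊖ = true

isNonzero-≢𝟎 : ∀ {s} → s ≢ 𝟎 → isNonzero s ≡ true
isNonzero-≢𝟎 {𝟎} s≢𝟎 = contradiction refl s≢𝟎
isNonzero-≢𝟎 {⊕} _   = refl
isNonzero-≢𝟎 {⊖} _   = refl

support : SignVec n → Subset n
support X = tabulate (isNonzero ∘ X)

supportSize≡∣support∣ : (X : SignVec n) → supportSize X ≡ ∣ support X ∣
supportSize≡∣support∣ X = trans (cong sum (map-tabulate id (nz ∘ X))) (sum≡∣support∣ X)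
  where
  sum≡∣support∣ : ∀ {n} (X : SignVec n) → sum (List.tabulate (nz ∘ X)) ≡ ∣ support X ∣
  sum≡∣support∣ {zero}  X = refl
  sum≡∣support∣ {suc n} X with X zero
  ... | 𝟎 = sum≡∣support∣ (X ∘ suc)
  ... | ⊕ = cong suc (sum≡∣support∣ (X ∘ suc))
  ... | ⊖ = cong suc (sum≡∣support∣ (X ∘ suc))

support-⟨⟩ : ∀ (p : Subset n) {s} → s ≢ 𝟎 → support (p ⟨ s ⟩) ≡ p
support-⟨⟩ p {s} s≢𝟎 = trans (tabulate-cong pointwise) (tabulate∘lookup p)
  where
  pointwise : ∀ e → isNonzero ((p ⟨ s ⟩) e) ≡ lookup p e
  pointwise e rewrite lookup-locate p e with locate p e
  ... | inj₁ _ = isNonzero-≢𝟎 s≢𝟎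
  ... | inj₂ _ = refl

_≟ˢ_ : DecidableEquality Sign
𝟎 ≟ˢ 𝟎 = yes refl
⊕ ≟ˢ ⊕ = yes refl
⊖ ≟ˢ ⊖ = yes refl
𝟎 ≟ˢ ⊕ = no λ ()
𝟎 ≟ˢ ⊖ = no λ ()
⊕ ≟ˢ 𝟎 = no λ ()
⊕ ≟ˢ ⊖ = no λ ()
⊖ ≟ˢ 𝟎 = no λ ()
⊖ ≟ˢ ⊕ = no λ ()

infix 4 _≗?_
_≗?_ : (X Y : SignVec n) → Dec (X ≗ Y)
X ≗? Y = all? λ e → X e ≟ˢ Y e

-- For p = ⊥ both p ⟨ ⊕ ⟩ and p ⟨ ⊖ ⟩ are the zero vector, which the test 0 < ∣ p ∣ rejects.
cycleOracle : Subset n → Oracle n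
cycleOracle p X = ⌊ 0 <? ∣ p ∣ ×-dec (X ≗? p ⟨ ⊕ ⟩ ⊎-dec X ≗? p ⟨ ⊖ ⟩) ⌋

cycleOracle-accepts : ∀ (p : Subset n) X →
                      cycleOracle p X ≡ true ⇔ (0 < ∣ p ∣ × (X ≗ p ⟨ ⊕ ⟩ ⊎ X ≗ p ⟨ ⊖ ⟩))
cycleOracle-accepts p X = mk⇔ (toWitness ∘ Equivalence.from T-≡) (Equivalence.to T-≡ ∘ fromWitness)

cycleOracle-graphic : (p : Subset n) → OrientedGraphic n (cycleOracle p)
cycleOracle-graphic p = cycleDigraph (locate p) , λ X →
  ⇔.trans (cycleOracle-accepts p X)
          (⇔.sym (SignedCycle-cycleDigraph (locate p) (locate-injective p)
                                            (select p) (locate-select p) X))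

cycleOracle-support : ∀ (p : Subset n) {X} → cycleOracle p X ≡ true → support X ≡ p
cycleOracle-support p {X} accepted =
  Sum.[ via (λ ()) , via (λ ()) ]′ (proj₂ (Equivalence.to (cycleOracle-accepts p X) accepted))
  where
  via : ∀ {s} → s ≢ 𝟎 → X ≗ p ⟨ s ⟩ → support X ≡ p
  via s≢𝟎 X≗ = trans (tabulate-cong (cong isNonzero ∘ X≗)) (support-⟨⟩ p s≢𝟎)

cycleOracle-⊥ : ∀ X → cycleOracle (⊥ {n}) X ≡ false
cycleOracle-⊥ {n} X = Equivalence.to T-not-≡ (fromWitnessFalse λ (0<∣⊥∣ , _) →
  contradiction (subst (0 <_) (∣⊥∣≡0 n) 0<∣⊥∣) λ ())

cycleOracle-separates : ∀ (p : Subset n) Y → cycleOracle p Y ≢ cycleOracle ⊥ Y → support Y ≡ p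
cycleOracle-separates p Y differ with cycleOracle p Y in accepted
... | true  = cycleOracle-support p accepted
... | false = contradiction (sym (cycleOracle-⊥ Y)) differ

cycleOracle-even : ∀ (p : Subset n) → 0 < ∣ p ∣ → 2 ∣ ∣ p ∣ →
                   HasEvenDirectedCircuit (cycleOracle p)
cycleOracle-even p 0<∣p∣ even =
  p ⟨ ⊕ ⟩ ,
  Equivalence.from (cycleOracle-accepts p (p ⟨ ⊕ ⟩)) (0<∣p∣ , inj₁ λ _ → refl) ,
  inj₁ (⟨⊕⟩-directed p) ,
  subst (2 ∣_) (sym (trans (supportSize≡∣support∣ (p ⟨ ⊕ ⟩)) (cong ∣_∣ (support-⟨⟩ p λ ())))) even

-- Decision trees

queries : DTree n → Oracle n → List (SignVec n)
queries (leaf _)      C = []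
queries (query Y t f) C with C Y
... | true  = Y ∷ queries t C
... | false = Y ∷ queries f C

length-queries : ∀ (T : DTree n) C → length (queries T C) ≡ calls T C
length-queries (leaf _)      C = refl
length-queries (query Y t f) C with C Y
... | true  = cong suc (length-queries t C)
... | false = cong suc (length-queries f C)

diverges-at-query : ∀ (T : DTree n) {C C₀} → run T C ≢ run T C₀ →
                    ∃ λ Y → Y ∈ queries T C₀ × C Y ≢ C₀ Y
diverges-at-query (leaf _) differ = contradiction refl differ
diverges-at-query (query Y t f) {C} {C₀} differ with C Y in CY | C₀ Y in C₀Y
... | true  | true  = Product.map₂ (Product.map₁ there) (diverges-at-query t differ)
... | false | false = Product.map₂ (Product.map₁ there) (diverges-at-query f differ)
... | true  | false = Y , here refl , λ same → contradiction (trans (sym CY) (trans same C₀Y)) λ ()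
... | false | true  = Y , here refl , λ same → contradiction (trans (sym CY) (trans same C₀Y)) λ ()

unique⊆⇒length≤ : ∀ {A : Set} {xs ys : List A} → Unique xs → xs ⊆ ys → length xs ≤ length ys
unique⊆⇒length≤ {xs = []}     _             _     = z≤n
unique⊆⇒length≤ {xs = x ∷ xs} (x∉xs ∷ uniq) xs⊆ys with ∈-∃++ (xs⊆ys (here refl))
... | ys₁ , ys₂ , refl = begin
  suc (length xs)           ≤⟨ s≤s (unique⊆⇒length≤ uniq xs⊆ys₁ys₂) ⟩
  suc (length (ys₁ ++ ys₂)) ≡⟨ length-++-sucʳ ys₁ x ys₂ ⟨
  length (ys₁ ++ x ∷ ys₂)   ∎
  where
  open ≤-Reasoning
  xs⊆ys₁ys₂ : xs ⊆ ys₁ ++ ys₂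
  xs⊆ys₁ys₂ {y} y∈xs with ∈-++⁻ ys₁ (xs⊆ys (there y∈xs))
  ... | inj₁ y∈ys₁         = ∈-++⁺ˡ y∈ys₁
  ... | inj₂ (here y≡x)    = contradiction (sym y≡x) (All.lookup x∉xs y∈xs)
  ... | inj₂ (there y∈ys₂) = ∈-++⁺ʳ ys₁ y∈ys₂

adversary : ∀ {A : Set} (key : SignVec n → A) (C : A → Oracle n) (C₀ : Oracle n) →
            (∀ a Y → C a Y ≢ C₀ Y → key Y ≡ a) →
            ∀ T {F : List A} → Unique F → (∀ {a} → a ∈ F → run T (C a) ≢ run T C₀) →
            length F ≤ calls T C₀
adversary key C C₀ separates T {F} uniq distinguished = begin
  length F                         ≤⟨ unique⊆⇒length≤ uniq F⊆keys ⟩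
  length (map key (queries T C₀))  ≡⟨ length-map key (queries T C₀) ⟩
  length (queries T C₀)            ≡⟨ length-queries T C₀ ⟩
  calls T C₀                       ∎
  where
  open ≤-Reasoning
  F⊆keys : F ⊆ map key (queries T C₀)
  F⊆keys a∈F with diverges-at-query T (distinguished a∈F)
  ... | Y , Y∈ , differ = subst (_∈ _) (separates _ Y differ) (∈-map⁺ key Y∈)

-- Even subsets

∣p∣≡0⇒p≡⊥ : ∀ (p : Subset n) → ∣ p ∣ ≡ 0 → p ≡ ⊥
∣p∣≡0⇒p≡⊥ []            _     = refl
∣p∣≡0⇒p≡⊥ (outside ∷ p) ∣p∣≡0 = cong (outside ∷_) (∣p∣≡0⇒p≡⊥ p ∣p∣≡0)

prepend : List (Subset n) → List (Subset n) → List (Subset (suc n))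
prepend ps qs = map (outside ∷_) ps ++ map (inside ∷_) qs

length-prepend : ∀ (ps qs : List (Subset n)) {m} → length ps ≡ 2 ^ m → length qs ≡ 2 ^ m →
                 length (prepend ps qs) ≡ 2 ^ suc m
length-prepend ps qs {m} ∣ps∣ ∣qs∣ = begin
  length (map (outside ∷_) ps ++ map (inside ∷_) qs) ≡⟨ length-++ (map (outside ∷_) ps) ⟩
  length (map (outside ∷_) ps) + length (map (inside ∷_) qs)
    ≡⟨ cong₂ _+_ (trans (length-map _ ps) ∣ps∣) (trans (length-map _ qs) ∣qs∣) ⟩
  2 ^ m + 2 ^ m                                        ≡⟨ cong (2 ^ m +_) (+-identityʳ (2 ^ m)) ⟨
  2 ^ suc m                                            ∎
  where open ≡-Reasoning

prepend-unique : {ps qs : List (Subset n)} → Unique ps → Unique qs → Unique (prepend ps qs)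
prepend-unique {ps = ps} {qs} ps! qs! =
  Unique.++⁺ (Unique.map⁺ ∷-injectiveʳ ps!) (Unique.map⁺ ∷-injectiveʳ qs!) disjoint
  where
  disjoint : ∀ {p} → ¬ (p ∈ map (outside ∷_) ps × p ∈ map (inside ∷_) qs)
  disjoint (p∈ , p∈′) with ∈-map⁻ _ p∈ | ∈-map⁻ _ p∈′
  ... | _ , _ , refl | _ , _ , ()

prepend-All : ∀ {P : Subset (suc n) → Set} {ps qs : List (Subset n)} →
              All (P ∘ (outside ∷_)) ps → All (P ∘ (inside ∷_)) qs → All P (prepend ps qs)
prepend-All Pps Pqs = All.++⁺ (All.map⁺ Pps) (All.map⁺ Pqs)

evenSubsets oddSubsets : (n : ℕ) → List (Subset n)
evenSubsets zero    = [ [] ]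
evenSubsets (suc n) = prepend (evenSubsets n) (oddSubsets n)
oddSubsets  zero    = []
oddSubsets  (suc n) = prepend (oddSubsets n) (evenSubsets n)

length-evenSubsets-suc : ∀ n → length (evenSubsets (suc n)) ≡ 2 ^ n
length-oddSubsets-suc  : ∀ n → length (oddSubsets  (suc n)) ≡ 2 ^ n
length-evenSubsets-suc zero    = refl
length-evenSubsets-suc (suc n) = length-prepend (evenSubsets (suc n)) (oddSubsets (suc n)) {m = n}
                                   (length-evenSubsets-suc n) (length-oddSubsets-suc n)
length-oddSubsets-suc  zero    = refl
length-oddSubsets-suc  (suc n) = length-prepend (oddSubsets (suc n)) (evenSubsets (suc n)) {m = n}
                                   (length-oddSubsets-suc n) (length-evenSubsets-suc n)

length-evenSubsets : ∀ n → length (evenSubsets n) ≡ 2 ^ (n ∸ 1)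
length-evenSubsets zero    = refl
length-evenSubsets (suc n) = length-evenSubsets-suc n

evenSubsets-unique : ∀ n → Unique (evenSubsets n)
oddSubsets-unique  : ∀ n → Unique (oddSubsets n)
evenSubsets-unique zero    = [] ∷ []
evenSubsets-unique (suc n) = prepend-unique (evenSubsets-unique n) (oddSubsets-unique n)
oddSubsets-unique  zero    = []
oddSubsets-unique  (suc n) = prepend-unique (oddSubsets-unique n) (evenSubsets-unique n)

evenSubsets-even : ∀ n → All (λ p → 2 ∣ ∣ p ∣) (evenSubsets n)
oddSubsets-odd   : ∀ n → All (λ p → 2 ∣ suc (∣ p ∣)) (oddSubsets n)
evenSubsets-even zero    = (2 ∣0) ∷ []
evenSubsets-even (suc n) = prepend-All (evenSubsets-even n) (oddSubsets-odd n)
oddSubsets-odd   zero    = []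
oddSubsets-odd   (suc n) =
  prepend-All (oddSubsets-odd n) (All.map (∣m∣n⇒∣m+n ∣-refl) (evenSubsets-even n))

evenSubsets-⊥ : ∀ n → ∃ λ ps → evenSubsets n ≡ ⊥ ∷ ps
evenSubsets-⊥ zero = [] , refl
evenSubsets-⊥ (suc n) with evenSubsets-⊥ n
... | ps , eq rewrite eq = _ , refl

nonemptyEvenSubsets : ∀ n → ∃ λ (F : List (Subset n)) →
  Unique F × length F ≡ 2 ^ (n ∸ 1) ∸ 1 × All (λ p → 0 < ∣ p ∣ × 2 ∣ ∣ p ∣) F
nonemptyEvenSubsets n
  with evenSubsets n | evenSubsets-⊥ n | evenSubsets-unique n | evenSubsets-even n
     | length-evenSubsets n
... | _ | F , refl | ⊥∉F ∷ F-unique | _ ∷ F-even | length≡ =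
  F , F-unique , cong (_∸ 1) length≡ , All.zipWith nonempty-even (⊥∉F , F-even)
  where
  nonempty-even : ∀ {p} → ⊥ ≢ p × 2 ∣ ∣ p ∣ → 0 < ∣ p ∣ × 2 ∣ ∣ p ∣
  nonempty-even {p} (⊥≢p , even) = n≢0⇒n>0 (⊥≢p ∘ sym ∘ ∣p∣≡0⇒p≡⊥ p) , even

proposition3p2 : ∀ (n : ℕ) (T : DTree n) → DecidesEvenDirectedCircuit T →
  ∃ λ (C : Oracle n) → OrientedGraphic n C × (2 ^ (n ∸ 1) ∸ 1 ≤ calls T C)
proposition3p2 n T decides
  with F , F-unique , length-F , F-nonempty-even ← nonemptyEvenSubsets n =
  cycleOracle ⊥ , cycleOracle-graphic ⊥ ,
  subst (_≤ calls T (cycleOracle ⊥)) length-F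
    (adversary support cycleOracle (cycleOracle ⊥) cycleOracle-separates T F-unique distinguished)
  where
  answer : ∀ p → (run T (cycleOracle p) ≡ true) ⇔ HasEvenDirectedCircuit (cycleOracle p)
  answer p = decides (cycleOracle p) (cycleOracle-graphic p)

  rejects-⊥ : run T (cycleOracle ⊥) ≡ false
  rejects-⊥ with run T (cycleOracle ⊥) in accepted
  ... | false = refl
  ... | true with X , X-accepted , _ ← Equivalence.to (answer ⊥) accepted =
    contradiction (trans (sym X-accepted) (cycleOracle-⊥ X)) λ ()

  distinguished : ∀ {p} → p ∈ F → run T (cycleOracle p) ≢ run T (cycleOracle ⊥)
  distinguished {p} p∈F same = contradiction (trans (sym accepts) (trans same rejects-⊥)) λ ()
    where
    accepts : run T (cycleOracle p) ≡ true
    accepts = Equivalence.from (answer p)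
                (Product.uncurry (cycleOracle-even p) (All.lookup F-nonempty-even p∈F))
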